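{- Let $[A,B,C]$ be an integral binary quadratic form with $B\equiv A+C\varepsilon\equiv0\pmod p$, let $M\in\Gamma_{ns}$ and $[A',B',C']=[A,B,C]\cdot M$. Then: (1) $A'\equiv A\pmod p$; (2) $B'\equiv B\pmod{2p}$; (3) $C'\equiv C\pmod p$; (4) $A-A'\equiv\varepsilon(C-C')\pmod{p^2}$. In particular $B'\equiv A'+C'\varepsilon\equiv 0\pmod p$.
   Context: $p$ is an odd prime and $\varepsilon$ an integer that is not a square modulo $p$ with $\varepsilon\equiv1\pmod4$. $M_{ns}=\{\left(\begin{smallmatrix} a&b\\ c&d\end{smallmatrix}\right)\in M_2(\mathbb{Z}): a\equiv d,\ b\varepsilon\equiv c\pmod p\}$ and $\Gamma_{ns}=M_{ns}\cap\mathrm{SL}_2(\mathbb{Z})$. $[A,B,C]$ denotes $AX^2+BXY+CY^2$, and for $M=\left(\begin{smallmatrix}\alpha&\beta\\ \gamma&\delta\end{smallmatrix}\right)\in\mathrm{SL}_2(\mathbb{Z})$, $[A,B,C]\cdot M=[A\alpha^2+B\alpha\gamma+C\gamma^2,\ 2A\alpha\beta+B(\alpha\delta+\beta\gamma)+2C\gamma\delta,\ A\beta^2+B\beta\delta+C\delta^2]$. -}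

module Defs where

open import Data.Nat using (ℕ)
open import Data.Nat.Primality using (Prime)
open import Data.Integer using (ℤ; +_; _+_; _-_; _*_)
open import Data.Integer.Divisibility using (_∣_)
open import Data.Product using (_×_; _,_; ∃)
open import Relation.Binary.PropositionalEquality using (_≡_)
open import Relation.Nullary using (¬_)

_≡_[mod_] : ℤ → ℤ → ℕ → Set
a ≡ b [mod m ] = (+ m) ∣ (a - b)

OddPrime : ℕ → Set
OddPrime p = Prime p × ¬ (p ≡ 2)

NonSquareMod : ℕ → ℤ → Set
NonSquareMod p ε = ¬ ∃ λ (x : ℤ) → (x * x) ≡ ε [mod p ]

-- integral binary quadratic form [A,B,C] = A X² + B XY + C Y²
record Form : Set where
  constructor [_,_,_]
  field
    A B C : ℤ

record Mat : Set where
  constructor mat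
  field
    α β γ δ : ℤ

det : Mat → ℤ
det (mat α β γ δ) = α * δ - β * γ

InΓns : ℕ → ℤ → Mat → Set
InΓns p ε M@(mat a b c d) = (a ≡ d [mod p ]) × ((b * ε) ≡ c [mod p ]) × (det M ≡ + 1)

_·_ : Form → Mat → Form
[ A , B , C ] · mat α β γ δ =
  [ A * α * α + B * α * γ + C * γ * γ
  , (+ 2) * A * α * β + B * (α * δ + β * γ) + (+ 2) * C * γ * δ
  , A * β * β + B * β * δ + C * δ * δ ]

module Submission where

-- Write M = (a b ; c d) ∈ Γ_ns and put
--   E = A + Cε,   X = a - d,   Y = bε - c,
-- so that the hypotheses say that p divides B, E, X and Y, and ad - bc = 1.
-- The proof is pure polynomial algebra: each difference A' - A, B' - B,
-- C' - C and (A - A') - ε(C - C') is written, by a ring identity, as an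
-- integral combination of B, E, X, Y and (ad - bc) - 1.  In the first three
-- every term contains one of these factors (the middle one with an extra
-- factor 2), and in the last every term contains a product of two of them
-- (or the vanishing factor (ad - bc) - 1), which gives divisibility by p².

open import Defs
open import Data.Nat using (ℕ; _^_) renaming (_*_ to _*ℕ_)
open import Data.Integer using (ℤ; +_; 0ℤ; _+_; _-_; _*_; -_)
open import Data.Integer.Properties using (pos-*; +-identityʳ; i≡j⇒i-j≡0)
open import Data.Integer.Divisibility.Signed
  using (_∣_; divides; ∣-refl; ∣-trans; ∣m∣n⇒∣m+n; ∣m∣n⇒∣m-n; ∣n⇒∣m*n; ∣m⇒∣m*n; ∣m⇒∣-m;
         *-monoʳ-∣; ∣⇒∣ᵤ; ∣ᵤ⇒∣)
open import Data.Integer.Divisibility using () renaming (_∣_ to _∣ᵤ_)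
open import Data.Integer.Tactic.RingSolver using (solve-∀)
open import Data.Product using (_×_; _,_)
open import Relation.Binary.PropositionalEquality using (_≡_; refl; sym; trans; cong; subst)
import Data.Nat.Properties as ℕ

infixl 6 _⊕_ _⊖_

_⊕_ : ∀ {k x y} → k ∣ x → k ∣ y → k ∣ x + y
_⊕_ = ∣m∣n⇒∣m+n

_⊖_ : ∀ {k x y} → k ∣ x → k ∣ y → k ∣ x - y
_⊖_ = ∣m∣n⇒∣m-n

-- Every integer divides the difference of two equal integers; this is how
-- the hypothesis det M = 1 enters the divisibility computations.
∣-diff-of-equal : ∀ {k x y} → x ≡ y → k ∣ x - y
∣-diff-of-equal {k} x≡y = subst (k ∣_) (sym (i≡j⇒i-j≡0 x≡y)) (divides 0ℤ refl)

-- If k divides x and y then k² divides xy; source of the modulus p².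
∣-product : ∀ {k x y} → k ∣ x → k ∣ y → (k * k) ∣ (x * y)
∣-product {k} (divides q refl) (divides r refl) = divides (q * r) (regroup q r k)
  where
    regroup : ∀ q r k → (q * k) * (r * k) ≡ (q * r) * (k * k)
    regroup = solve-∀

∣-minus-zero : ∀ {k x} → k ∣ x - 0ℤ → k ∣ x
∣-minus-zero {k} {x} = subst (k ∣_) (+-identityʳ x)

∣-to-minus-zero : ∀ {k x} → k ∣ x → k ∣ x - 0ℤ
∣-to-minus-zero {k} {x} = subst (k ∣_) (sym (+-identityʳ x))

first-identity : ∀ A B C ε a b c d →
  (A * a * a + B * a * c + C * c * c) - A ≡
  (A + C * ε) * (a * a - + 1) + a * c * B - (C * c) * (b * ε - c) - (C * ε * a) * (a - d)
    + (C * ε) * (+ 1 - (a * d - b * c))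
first-identity = solve-∀

third-identity : ∀ A B C ε a b c d →
  (A * b * b + B * b * d + C * d * d) - C ≡
  (A + C * ε) * (b * b) + b * d * B - (C * d) * (a - d) - (C * b) * (b * ε - c)
    + C * ((a * d - b * c) - + 1)
third-identity = solve-∀

middle-identity : ∀ A B C ε a b c d →
  ((+ 2) * A * a * b + B * (a * d + b * c) + (+ 2) * C * c * d) - B ≡
  + 2 * (a * b * (A + C * ε) + b * c * B - (C * c) * (a - d) - (C * a) * (b * ε - c))
    + B * ((a * d - b * c) - + 1)
middle-identity = solve-∀

-- Every summand is a product of two of B, E, X, Y, or contains ad - bc - 1.
quadratic-identity : ∀ A B C ε a b c d →
  (A - (A * a * a + B * a * c + C * c * c)) - ε * (C - (A * b * b + B * b * d + C * d * d)) ≡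
  - ((A + C * ε) * (a - d) * a - (A + C * ε) * (b * ε - c) * b
     + (A + C * ε) * ((a * d - b * c) - + 1)
     + B * (ε * b * (a - d) - a * (b * ε - c))
     + C * ((b * ε - c) * (b * ε - c) - ε * ((a - d) * (a - d)))
     + + 2 * ε * C * (+ 1 - (a * d - b * c)))
quadratic-identity = solve-∀

module Invariance
  (k A B C ε a b c d : ℤ)
  (k∣B : k ∣ B) (k∣E : k ∣ A + C * ε) (k∣X : k ∣ a - d) (k∣Y : k ∣ b * ε - c)
  (det≡1 : a * d - b * c ≡ + 1)
  where

  A' B' C' : ℤ
  A' = Form.A ([ A , B , C ] · mat a b c d)
  B' = Form.B ([ A , B , C ] · mat a b c d)
  C' = Form.C ([ A , B , C ] · mat a b c d)

  first-coefficient : k ∣ A' - A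
  first-coefficient = subst (k ∣_) (sym (first-identity A B C ε a b c d))
    (∣m⇒∣m*n (a * a - + 1) k∣E ⊕ ∣n⇒∣m*n (a * c) k∣B ⊖ ∣n⇒∣m*n (C * c) k∣Y
      ⊖ ∣n⇒∣m*n (C * ε * a) k∣X ⊕ ∣n⇒∣m*n (C * ε) (∣-diff-of-equal (sym det≡1)))

  third-coefficient : k ∣ C' - C
  third-coefficient = subst (k ∣_) (sym (third-identity A B C ε a b c d))
    (∣m⇒∣m*n (b * b) k∣E ⊕ ∣n⇒∣m*n (b * d) k∣B ⊖ ∣n⇒∣m*n (C * d) k∣X
      ⊖ ∣n⇒∣m*n (C * b) k∣Y ⊕ ∣n⇒∣m*n C (∣-diff-of-equal det≡1))

  middle-coefficient : (+ 2 * k) ∣ B' - B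
  middle-coefficient = subst (+ 2 * k ∣_) (sym (middle-identity A B C ε a b c d))
    (*-monoʳ-∣ (+ 2) half ⊕ ∣n⇒∣m*n B (∣-diff-of-equal det≡1))
    where
      half : k ∣ a * b * (A + C * ε) + b * c * B - (C * c) * (a - d) - (C * a) * (b * ε - c)
      half = ∣n⇒∣m*n (a * b) k∣E ⊕ ∣n⇒∣m*n (b * c) k∣B ⊖ ∣n⇒∣m*n (C * c) k∣X
        ⊖ ∣n⇒∣m*n (C * a) k∣Y

  quadratic-relation : (k * k) ∣ (A - A') - ε * (C - C')
  quadratic-relation = subst (k * k ∣_) (sym (quadratic-identity A B C ε a b c d))
    (∣m⇒∣-m (∣m⇒∣m*n a (∣-product k∣E k∣X) ⊖ ∣m⇒∣m*n b (∣-product k∣E k∣Y)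
      ⊕ ∣n⇒∣m*n (A + C * ε) (∣-diff-of-equal det≡1)
      ⊕ ∣-product k∣B (∣n⇒∣m*n (ε * b) k∣X ⊖ ∣n⇒∣m*n a k∣Y)
      ⊕ ∣n⇒∣m*n C (∣-product k∣Y k∣Y ⊖ ∣n⇒∣m*n ε (∣-product k∣X k∣X))
      ⊕ ∣n⇒∣m*n (+ 2 * ε * C) (∣-diff-of-equal (sym det≡1))))

  middle-vanishes : k ∣ B'
  middle-vanishes = subst (k ∣_) (recombine B' B)
    (∣-trans (∣n⇒∣m*n (+ 2) ∣-refl) middle-coefficient ⊕ k∣B)
    where
      recombine : ∀ B' B → (B' - B) + B ≡ B'
      recombine = solve-∀

  norm-vanishes : k ∣ A' + C' * ε
  norm-vanishes = subst (k ∣_) (recombine A A' C C' ε)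
    (first-coefficient ⊕ ∣m⇒∣m*n ε third-coefficient ⊕ k∣E)
    where
      recombine : ∀ A A' C C' ε → (A' - A) + (C' - C) * ε + (A + C * ε) ≡ A' + C' * ε
      recombine = solve-∀

∣⇒∣ᵤ-at : ∀ {m n z} → + m ≡ n → n ∣ z → (+ m) ∣ᵤ z
∣⇒∣ᵤ-at refl = ∣⇒∣ᵤ

+[p^2]≡+p*+p : ∀ p → + (p ^ 2) ≡ + p * + p
+[p^2]≡+p*+p p = trans (cong (λ n → + (p *ℕ n)) (ℕ.*-identityʳ p)) (pos-* p p)

-- Lemma 5.1.
lemma5p1 : (p : ℕ) → OddPrime p → (ε : ℤ) → NonSquareMod p ε → ε ≡ + 1 [mod 4 ] →
    (A B C : ℤ) → B ≡ + 0 [mod p ] → (A + C * ε) ≡ + 0 [mod p ] →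
    (M : Mat) → InΓns p ε M →
    (A' B' C' : ℤ) → [ A' , B' , C' ] ≡ [ A , B , C ] · M →
    (A' ≡ A [mod p ]) × (B' ≡ B [mod 2 *ℕ p ]) × (C' ≡ C [mod p ])
    × ((A - A') ≡ ε * (C - C') [mod p ^ 2 ])
    × (B' ≡ + 0 [mod p ]) × ((A' + C' * ε) ≡ + 0 [mod p ])
lemma5p1 p _ ε _ _ A B C B≡0 E≡0 (mat a b c d) (a≡d , bε≡c , det≡1) _ _ _ refl =
    ∣⇒∣ᵤ-at refl first-coefficient
  , ∣⇒∣ᵤ-at (pos-* 2 p) middle-coefficient
  , ∣⇒∣ᵤ-at refl third-coefficient
  , ∣⇒∣ᵤ-at (+[p^2]≡+p*+p p) quadratic-relation
  , ∣⇒∣ᵤ-at refl (∣-to-minus-zero middle-vanishes)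
  , ∣⇒∣ᵤ-at refl (∣-to-minus-zero norm-vanishes)
  where
    open Invariance (+ p) A B C ε a b c d
      (∣-minus-zero (∣ᵤ⇒∣ B≡0)) (∣-minus-zero (∣ᵤ⇒∣ E≡0)) (∣ᵤ⇒∣ a≡d) (∣ᵤ⇒∣ bε≡c) det≡1
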